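{- Each of the following principles on its own implies Rosolini choice (i.e. for all $P,Q:\mathcal U$, $\operatorname{isRosolini}(P)\to(P\to\lVert\operatorname{rosoliniStructure}(Q)\rVert)\to\lVert P\to\operatorname{rosoliniStructure}(Q)\rVert$): (1) countable choice; (2) for every type $A$ and every $\alpha:\mathbb N\to2$, $\big(\prod_{n}\lVert(\alpha_n=1)\to A\rVert\big)\to\lVert\prod_n((\alpha_n=1)\to A)\rVert$; (3) untruncated LPO: $\prod_{\alpha:\mathbb N\to 2}\big(\langle\alpha\rangle+(\alpha=\lambda n.0)\big)$; (4) untruncated WLPO: $\prod_{\alpha:\mathbb N\to2}\big(\langle\alpha\rangle+\neg\langle\alpha\rangle\big)$; (5) truncated WLPO: $\prod_{\alpha:\mathbb N\to2}\lVert\langle\alpha\rangle+\neg\langle\alpha\rangle\rVert$; (6) propositional choice: for all $P,A:\mathcal U$ with $A$ a set and $P$ a proposition, $(P\to\lVert A\rVert)\to\lVert P\to A\rVert$.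
   Context: Type theory: Martin-Löf type theory with universe $\mathcal U$, function extensionality, proposition extensionality and propositional truncations $\lVert X\rVert$. For $\alpha:\mathbb N\to 2$ let $\langle\alpha\rangle:=\sum_{n:\mathbb N}(\alpha_n=1)$; $\mathbb N_\infty:=\sum_{\alpha:\mathbb N\to2}\operatorname{isProp}(\langle\alpha\rangle)$, and for $u:\mathbb N_\infty$, $\langle u\rangle$ is $\langle\alpha\rangle$ of its underlying sequence. $\operatorname{rosoliniStructure}(P):=\sum_{u:\mathbb N_\infty}(P=\langle u\rangle)$ and $\operatorname{isRosolini}(P):=\lVert\operatorname{rosoliniStructure}(P)\rVert$. Countable choice: for every family $Y:\mathbb N\to\mathcal U$, $\big(\prod_{n}\lVert Y(n)\rVert\big)\to\lVert\prod_n Y(n)\rVert$. A set is a type whose identity types are propositions. -}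

module Defs where

open import Level using (Level; _⊔_; Setω) renaming (suc to lsuc; zero to lzero)
open import Data.Nat using (ℕ)
open import Data.Bool using (Bool; true; false)
open import Data.Product using (Σ; _×_; _,_; proj₁; proj₂)
open import Data.Sum using (_⊎_)
open import Relation.Nullary using (¬_)
open import Relation.Binary.PropositionalEquality using (_≡_)

isProp : ∀ {ℓ} → Set ℓ → Set ℓ
isProp X = (x y : X) → x ≡ y

isSet : ∀ {ℓ} → Set ℓ → Set ℓ
isSet X = (x y : X) → isProp (x ≡ y)

-- The ambient axioms of the paper: propositional truncations (at all levels),
-- function extensionality and proposition extensionality (for the universe U = Set).
-- Plain Agda has no HITs, so these are taken as an abstract structure.
record Axioms : Setω where
  field
    ∥_∥       : ∀ {ℓ} → Set ℓ → Set ℓ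
    ∣_∣       : ∀ {ℓ} {A : Set ℓ} → A → ∥ A ∥
    ∥∥-isProp : ∀ {ℓ} {A : Set ℓ} → isProp ∥ A ∥
    ∥∥-rec    : ∀ {ℓ ℓ'} {A : Set ℓ} {B : Set ℓ'} → isProp B → (A → B) → ∥ A ∥ → B
    funext    : ∀ {ℓ ℓ'} {A : Set ℓ} {B : A → Set ℓ'} {f g : (x : A) → B x}
              → ((x : A) → f x ≡ g x) → f ≡ g
    propext   : {P Q : Set} → isProp P → isProp Q → (P → Q) → (Q → P) → P ≡ Q

-- 2 is Bool, with 1 = true and 0 = false.
⟨_⟩ : (ℕ → Bool) → Set
⟨ α ⟩ = Σ ℕ (λ n → α n ≡ true)

ℕ∞ : Set
ℕ∞ = Σ (ℕ → Bool) (λ α → isProp ⟨ α ⟩)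

⟨_⟩∞ : ℕ∞ → Set
⟨ u ⟩∞ = ⟨ proj₁ u ⟩

rosoliniStructure : Set → Set₁
rosoliniStructure P = Σ ℕ∞ (λ u → P ≡ ⟨ u ⟩∞)

module WithAxioms (ax : Axioms) where
  open Axioms ax

  isRosolini : Set → Set₁
  isRosolini P = ∥ rosoliniStructure P ∥

  RosoliniChoice : Set₁
  RosoliniChoice = (P Q : Set) → isRosolini P
    → (P → ∥ rosoliniStructure Q ∥) → ∥ (P → rosoliniStructure Q) ∥

  CountableChoice : Set₁
  CountableChoice = (Y : ℕ → Set) → ((n : ℕ) → ∥ Y n ∥) → ∥ ((n : ℕ) → Y n) ∥

  Principle2 : Set₁
  Principle2 = (A : Set) (α : ℕ → Bool)
    → ((n : ℕ) → ∥ (α n ≡ true → A) ∥) → ∥ ((n : ℕ) → (α n ≡ true → A)) ∥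

  LPO : Set
  LPO = (α : ℕ → Bool) → ⟨ α ⟩ ⊎ (α ≡ (λ _ → false))

  WLPO : Set
  WLPO = (α : ℕ → Bool) → ⟨ α ⟩ ⊎ ¬ ⟨ α ⟩

  TruncatedWLPO : Set
  TruncatedWLPO = (α : ℕ → Bool) → ∥ ⟨ α ⟩ ⊎ ¬ ⟨ α ⟩ ∥

  PropositionalChoice : Set₁
  PropositionalChoice = (P A : Set) → isSet A → isProp P
    → (P → ∥ A ∥) → ∥ (P → A) ∥

-- A Rosolini proposition P is equal to ⟨ u ⟩∞ for some u : ℕ∞, so Rosolini
-- choice only asks for choice over the propositions ⟨ u ⟩∞ with values in
-- rosoliniStructure Q, which is (equivalent to) a small set. Each of the six
-- principles provides such choice: (6) directly, since ⟨ u ⟩∞ is a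
-- proposition; (2) because ⟨ α ⟩ → X is ∀ n → α n ≡ true → X and choice over
-- the decidable proposition α n ≡ true is trivial; (1) is an instance of (2);
-- and (5) decides ⟨ α ⟩ inside the truncation, with (3) ⇒ (4) ⇒ (5).
module Submission where

open import Defs
open import Level using (Level)
open import Function using (_∘_)
open import Data.Nat using (ℕ)
open import Data.Bool using (Bool; true; false)
open import Data.Bool.Properties using (_≟_)
open import Data.Product using (Σ; _×_; _,_; proj₁; proj₂; curry; uncurry)
open import Data.Sum using (_⊎_; inj₁; inj₂; [_,_]′)
open import Data.Empty using (⊥-elim)
open import Relation.Nullary using (Dec; yes; no; ¬_)
open import Relation.Binary.PropositionalEquality
  using (_≡_; refl; sym; cong; cong₂; cong-app; subst)
open import Axiom.UniquenessOfIdentityProofs using (module Constant⇒UIP; module Decidable⇒UIP)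

private
  variable
    a b : Level

isProp⇒isSet : {A : Set a} → isProp A → isSet A
isProp⇒isSet A-prop x y = Constant⇒UIP.≡-irrelevant (λ {x} {y} _ → A-prop x y) (λ _ _ → refl)

isSet-Bool : isSet Bool
isSet-Bool _ _ = Decidable⇒UIP.≡-irrelevant _≟_

Σ-isSet : {A : Set a} {B : A → Set b} →
          isSet A → ((x : A) → isProp (B x)) → isSet (Σ A B)
Σ-isSet {A = A} {B} A-set B-prop _ _ =
  Constant⇒UIP.≡-irrelevant (λ p → ≡-fromProj₁ (cong proj₁ p))
    (λ p q → cong ≡-fromProj₁ (A-set _ _ (cong proj₁ p) (cong proj₁ q)))
  where
  ≡-fromProj₁ : {x y : Σ A B} → proj₁ x ≡ proj₁ y → x ≡ y
  ≡-fromProj₁ {x , bx} {.x , by} refl = cong (x ,_) (B-prop x bx by)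

module Rosolini (ax : Axioms) where
  open Axioms ax
  open WithAxioms ax

  isProp-isProp : {A : Set a} → isProp (isProp A)
  isProp-isProp p q = funext λ x → funext λ y → isProp⇒isSet p x y (p x y) (q x y)

  Π-isSet : {A : Set a} {B : A → Set b} →
            ((x : A) → isSet (B x)) → isSet ((x : A) → B x)
  Π-isSet B-set _ _ =
    Constant⇒UIP.≡-irrelevant (λ p → funext (cong-app p))
      (λ p q → cong funext (funext λ x → B-set x _ _ (cong-app p x) (cong-app q x)))

  ∥∥-map : {A : Set a} {B : Set b} → (A → B) → ∥ A ∥ → ∥ B ∥
  ∥∥-map f = ∥∥-rec ∥∥-isProp (∣_∣ ∘ f)

  -- rosoliniStructure Q lives in Set₁, out of reach of the choice principles;
  -- this copy lives in Set and is a set.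
  SmallRosoliniStructure : Set → Set
  SmallRosoliniStructure Q =
    Σ (ℕ → Bool) λ α → isProp Q × isProp ⟨ α ⟩ × (Q → ⟨ α ⟩) × (⟨ α ⟩ → Q)

  isSet-SmallRosoliniStructure : (Q : Set) → isSet (SmallRosoliniStructure Q)
  isSet-SmallRosoliniStructure Q = Σ-isSet (Π-isSet λ _ → isSet-Bool) fields-isProp
    where
    fields-isProp : (α : ℕ → Bool) → isProp (isProp Q × isProp ⟨ α ⟩ × (Q → ⟨ α ⟩) × (⟨ α ⟩ → Q))
    fields-isProp α (Q-prop , α-prop , _ , _) (Q-prop′ , α-prop′ , _ , _) =
      cong₂ _,_ (isProp-isProp Q-prop Q-prop′) (cong₂ _,_ (isProp-isProp α-prop α-prop′)
        (cong₂ _,_ (funext λ _ → α-prop _ _) (funext λ _ → Q-prop _ _)))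

  small⇒rosoliniStructure : {Q : Set} → SmallRosoliniStructure Q → rosoliniStructure Q
  small⇒rosoliniStructure (α , Q-prop , α-prop , to , from) =
    (α , α-prop) , propext Q-prop α-prop to from

  rosoliniStructure⇒small : {Q : Set} → rosoliniStructure Q → SmallRosoliniStructure Q
  rosoliniStructure⇒small ((α , α-prop) , Q≡α) =
    α , subst isProp (sym Q≡α) α-prop , α-prop , subst (λ X → X) Q≡α , subst (λ X → X) (sym Q≡α)

  ChoiceOverRosolini : Set₁
  ChoiceOverRosolini =
    (u : ℕ∞) (X : Set) → isSet X → (⟨ u ⟩∞ → ∥ X ∥) → ∥ (⟨ u ⟩∞ → X) ∥

  ChoiceOverRosolini⇒RosoliniChoice : ChoiceOverRosolini → RosoliniChoice
  ChoiceOverRosolini⇒RosoliniChoice choice P Q P-rosolini P⇒Q-rosolini =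
    ∥∥-rec ∥∥-isProp choose P-rosolini
    where
    choose : rosoliniStructure P → ∥ (P → rosoliniStructure Q) ∥
    choose (u , P≡u) =
      ∥∥-map (λ f → small⇒rosoliniStructure ∘ f ∘ subst (λ X → X) P≡u)
        (choice u (SmallRosoliniStructure Q) (isSet-SmallRosoliniStructure Q)
          (∥∥-map rosoliniStructure⇒small ∘ P⇒Q-rosolini ∘ subst (λ X → X) (sym P≡u)))

  decidableChoice : {P : Set} {X : Set a} → Dec P → (P → ∥ X ∥) → ∥ (P → X) ∥
  decidableChoice (yes p) f = ∥∥-map (λ x _ → x) (f p)
  decidableChoice (no ¬p) _ = ∣ ⊥-elim ∘ ¬p ∣

  PropositionalChoice⇒ChoiceOverRosolini : PropositionalChoice → ChoiceOverRosolini
  PropositionalChoice⇒ChoiceOverRosolini choice (α , α-prop) X X-set =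
    choice ⟨ α ⟩ X X-set α-prop

  Principle2⇒ChoiceOverRosolini : Principle2 → ChoiceOverRosolini
  Principle2⇒ChoiceOverRosolini choice (α , _) X _ f =
    ∥∥-map uncurry (choice X α λ n → decidableChoice (α n ≟ true) (curry f n))

  CountableChoice⇒Principle2 : CountableChoice → Principle2
  CountableChoice⇒Principle2 choice X α = choice λ n → α n ≡ true → X

  TruncatedWLPO⇒ChoiceOverRosolini : TruncatedWLPO → ChoiceOverRosolini
  TruncatedWLPO⇒ChoiceOverRosolini wlpo (α , _) _ _ f =
    ∥∥-rec ∥∥-isProp (λ α-decided → decidableChoice (toDec α-decided) f) (wlpo α)
    where
    toDec : ⟨ α ⟩ ⊎ ¬ ⟨ α ⟩ → Dec ⟨ α ⟩
    toDec = [ yes , no ]′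

  WLPO⇒TruncatedWLPO : WLPO → TruncatedWLPO
  WLPO⇒TruncatedWLPO wlpo = ∣_∣ ∘ wlpo

  LPO⇒WLPO : LPO → WLPO
  LPO⇒WLPO lpo α with lpo α
  ... | inj₁ α-hit = inj₁ α-hit
  ... | inj₂ α≡0   = inj₂ λ { (n , αn≡1) → false≢true (subst (λ β → β n ≡ true) α≡0 αn≡1) }
    where
    false≢true : ¬ (false ≡ true)
    false≢true ()

theorem5p33 : (ax : Axioms)
    → (WithAxioms.CountableChoice ax → WithAxioms.RosoliniChoice ax)
    × (WithAxioms.Principle2 ax → WithAxioms.RosoliniChoice ax)
    × (WithAxioms.LPO ax → WithAxioms.RosoliniChoice ax)
    × (WithAxioms.WLPO ax → WithAxioms.RosoliniChoice ax)
    × (WithAxioms.TruncatedWLPO ax → WithAxioms.RosoliniChoice ax)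
    × (WithAxioms.PropositionalChoice ax → WithAxioms.RosoliniChoice ax)
theorem5p33 ax =
    rosolini ∘ Principle2⇒ChoiceOverRosolini ∘ CountableChoice⇒Principle2
  , rosolini ∘ Principle2⇒ChoiceOverRosolini
  , rosolini ∘ TruncatedWLPO⇒ChoiceOverRosolini ∘ WLPO⇒TruncatedWLPO ∘ LPO⇒WLPO
  , rosolini ∘ TruncatedWLPO⇒ChoiceOverRosolini ∘ WLPO⇒TruncatedWLPO
  , rosolini ∘ TruncatedWLPO⇒ChoiceOverRosolini
  , rosolini ∘ PropositionalChoice⇒ChoiceOverRosolini
  where
  open Rosolini ax
  rosolini : ChoiceOverRosolini → WithAxioms.RosoliniChoice ax
  rosolini = ChoiceOverRosolini⇒RosoliniChoice
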